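{- Let $Z$ be a set and $\mathcal{Y}\subseteq\mathcal{P}(Z)$ containing all singletons, closed under finite unions and arbitrary intersections. Let $\prec$ be a ranked relation on $Z$ (a ranked preferential structure $\mathcal{Z}$ without copies), and define $\mu(X):=\overbrace{\mu_{\mathcal{Z}}(X)}$ for $X\in\mathcal{Y}$. Then: (1) $\mu_{\mathcal{Z}}(X)=\{x\in X:\forall y\in X.\,x\in\mu(\{x,y\})\}$, so $\mu_{\mathcal{Z}}(X)=\mu_3(X)$ for $X\in\mathcal{Y}$; (2) $\mu(X)=\mu_{\mathcal{Z}}(X)$ for finite $X\in\mathcal{Y}$; (3) $\mu$ satisfies $(\mu=)$ for finite sets; (4) $\mu$ satisfies $(\mu\in)$; (5) $\mu$ satisfies $(\mu\emptyset fin)$; (6) $\mu$ satisfies $(\mu PR3)$.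
   Context: A relation $\prec$ on $Z$ is ranked iff there is a map $f$ from $Z$ into a strictly totally ordered set $(O,<_O)$ with $u\prec u'$ iff $f(u)<_O f(u')$. $\mu_{\mathcal{Z}}(X):=\{x\in X:\neg\exists x'\in X.\,x'\prec x\}$. For $A\subseteq Z$, $\overbrace{A}:=\bigcap\{X\in\mathcal{Y}:A\subseteq X\}$. For $B\in\mathcal{Y}$ and $A\subseteq B$, $A$ is small in $B$ iff no $X\in\mathcal{Y}$ satisfies $B-A\subseteq X\subsetneq B$. $\mu_3(U):=\{x\in U:\forall y\in U.\,x\in\mu(\{x,y\})\}$. Conditions (sets in $\mathcal{Y}$): $(\mu=)$ for finite sets: for finite $X\subseteq Y$, $\mu(Y)\cap X\neq\emptyset\Rightarrow\mu(Y)\cap X=\mu(X)$; $(\mu\in)$: $a\in X-\mu(X)\Rightarrow\exists b\in X.\,a\notin\mu(\{a,b\})$; $(\mu\emptyset fin)$: $X$ finite nonempty $\Rightarrow\mu(X)\neq\emptyset$; $(\mu PR3)$: for every $U\in\mathcal{Y}$, $\mu(U)-\mu_3(U)$ is small in $\mu(U)$. -}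

module Defs where

open import Level using (Level; 0ℓ; suc)
open import Data.Product using (Σ; ∃; ∃-syntax; _×_; _,_)
open import Data.Sum using (_⊎_)
open import Data.List using (List)
open import Data.List.Membership.Propositional using () renaming (_∈_ to _∈ₗ_)
open import Relation.Nullary using (¬_)
open import Relation.Binary using (Rel)
open import Relation.Binary.Bundles using (StrictTotalOrder)
open import Relation.Binary.PropositionalEquality using (_≡_)
open import Relation.Unary using (Pred; _∈_; _∉_; _⊆_; _≐_; _∪_; ｛_｝)

ContainsSingletons : {Z : Set} → Pred (Pred Z 0ℓ) 0ℓ → Set
ContainsSingletons {Z} 𝒴 = (z : Z) → ｛ z ｝ ∈ 𝒴

ClosedUnion : {Z : Set} → Pred (Pred Z 0ℓ) 0ℓ → Set₁
ClosedUnion {Z} 𝒴 = (X Y : Pred Z 0ℓ) → X ∈ 𝒴 → Y ∈ 𝒴 → (X ∪ Y) ∈ 𝒴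

ClosedIntersection : {Z : Set} → Pred (Pred Z 0ℓ) 0ℓ → Set₁
ClosedIntersection {Z} 𝒴 =
  (I : Set) (F : I → Pred Z 0ℓ) → (∀ i → F i ∈ 𝒴) → (λ z → ∀ i → F i z) ∈ 𝒴

Ranked : {Z : Set} → Rel Z 0ℓ → Set₁
Ranked {Z} _≺_ =
  Σ (StrictTotalOrder 0ℓ 0ℓ 0ℓ) λ O →
    Σ (Z → StrictTotalOrder.Carrier O) λ f →
      ∀ u u' → (u ≺ u' → StrictTotalOrder._<_ O (f u) (f u'))
             × (StrictTotalOrder._<_ O (f u) (f u') → u ≺ u')

Finite : {Z : Set} {ℓ : Level} → Pred Z ℓ → Set ℓ
Finite {Z} X = ∃[ xs ] ((z : Z) → (z ∈ X → z ∈ₗ xs) × (z ∈ₗ xs → z ∈ X))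

NonEmpty : {Z : Set} {ℓ : Level} → Pred Z ℓ → Set ℓ
NonEmpty X = ∃ λ z → z ∈ X

pair : {Z : Set} → Z → Z → Pred Z 0ℓ
pair x y = λ z → z ≡ x ⊎ z ≡ y

module Structure {Z : Set} (𝒴 : Pred (Pred Z 0ℓ) 0ℓ) (_≺_ : Rel Z 0ℓ) where

  μZ : Pred Z 0ℓ → Pred Z 0ℓ
  μZ X = λ x → x ∈ X × ¬ (∃ λ x' → x' ∈ X × x' ≺ x)

  -- overbrace A = ⋂ { X ∈ 𝒴 : A ⊆ X }
  cl : Pred Z 0ℓ → Pred Z (suc 0ℓ)
  cl A = λ z → (X : Pred Z 0ℓ) → X ∈ 𝒴 → A ⊆ X → z ∈ X

  μ : Pred Z 0ℓ → Pred Z (suc 0ℓ)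
  μ X = cl (μZ X)

  μ₃ : Pred Z 0ℓ → Pred Z (suc 0ℓ)
  μ₃ U = λ x → x ∈ U × ((y : Z) → y ∈ U → x ∈ μ (pair x y))

  Small : {ℓa ℓb : Level} → Pred Z ℓa → Pred Z ℓb → Set _
  Small A B = ¬ (∃ λ X → X ∈ 𝒴 × ((λ z → z ∈ B × z ∉ A) ⊆ X) × (X ⊆ B) × ¬ (B ⊆ X))

  μ=fin : Set₁
  μ=fin = (X Y : Pred Z 0ℓ) → X ∈ 𝒴 → Y ∈ 𝒴 → Finite X → Finite Y → X ⊆ Y →
          (∃ λ z → z ∈ μ Y × z ∈ X) → (μ Y ∩' X) ≐ μ X
    where
      _∩'_ : Pred Z (suc 0ℓ) → Pred Z 0ℓ → Pred Z (suc 0ℓ)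
      A ∩' B = λ z → z ∈ A × z ∈ B

  μ∈ : Set₁
  μ∈ = (X : Pred Z 0ℓ) → X ∈ 𝒴 → (a : Z) → a ∈ X → a ∉ μ X →
       ∃ λ b → b ∈ X × a ∉ μ (pair a b)

  μ∅fin : Set₁
  μ∅fin = (X : Pred Z 0ℓ) → X ∈ 𝒴 → Finite X → NonEmpty X → NonEmpty (μ X)

  μPR3 : Set₁
  μPR3 = (U : Pred Z 0ℓ) → U ∈ 𝒴 → Small (λ z → z ∈ μ U × z ∉ μ₃ U) (μ U)

  Fact4-14 : Set₁
  Fact4-14 =
      ((X : Pred Z 0ℓ) → μZ X ≐ (λ x → x ∈ X × ((y : Z) → y ∈ X → x ∈ μ (pair x y))))
    × ((X : Pred Z 0ℓ) → X ∈ 𝒴 → μZ X ≐ μ₃ X)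
    × ((X : Pred Z 0ℓ) → X ∈ 𝒴 → Finite X → μ X ≐ μZ X)
    × μ=fin × μ∈ × μ∅fin × μPR3

-- A ranked relation is irreflexive and cotransitive, and every nonempty finite set has a
-- minimal element. As 𝒴 contains the singletons, x ∉ μ {x , y} exactly when y ≺ x, which
-- gives (1), and from it (4) and (6). For finite X ∈ 𝒴 the set μ_𝒵 X is empty or a finite
-- union of singletons, hence its own closure; this is (2), and (3) and (5) reduce to
-- cotransitivity and the existence of minima.
module Submission where

open import Defs
open import Level using (0ℓ; suc)
open import Axiom.ExcludedMiddle using (ExcludedMiddle)
open import Relation.Binary using (Rel)

open import Data.Product using (∃; _×_; _,_; proj₁; proj₂)
open import Data.Empty using (⊥-elim)
open import Data.Sum using (inj₁; inj₂; [_,_]′)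
open import Data.List using (List; []; _∷_; filter)
open import Data.List.Relation.Unary.Any using (here; there)
import Data.List.Relation.Unary.All as All
open import Data.List.Membership.Propositional using () renaming (_∈_ to _∈ₗ_)
open import Data.List.Membership.Propositional.Properties using (∈-filter⁺; ∈-filter⁻)
open import Relation.Nullary using (¬_; yes; no)
open import Relation.Binary.Bundles using (StrictTotalOrder)
open import Relation.Binary.Definitions using (Irreflexive; Cotransitive; tri<; tri≈; tri>)
open import Relation.Binary.PropositionalEquality using (_≡_; refl)
open import Relation.Unary using (Pred; _∈_; _∉_; _⊆_; _≐_; _∩_; _∪_; ｛_｝)

module RankedRelation {Z : Set} {_≺_ : Rel Z 0ℓ} (ranked : Ranked _≺_) where

  private
    O : StrictTotalOrder 0ℓ 0ℓ 0ℓ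
    O = proj₁ ranked
    open StrictTotalOrder O
    import Relation.Binary.Properties.StrictTotalOrder O as NonStrict
    open import Data.List.Extrema NonStrict.totalOrder
      using (argmin; argmin-sel; f[argmin]≤f[⊤]; f[argmin]≤f[xs])

    f : Z → Carrier
    f = proj₁ (proj₂ ranked)

    ≺⇒< : ∀ {u u'} → u ≺ u' → f u < f u'
    ≺⇒< {u} {u'} = proj₁ (proj₂ (proj₂ ranked) u u')

    <⇒≺ : ∀ {u u'} → f u < f u' → u ≺ u'
    <⇒≺ {u} {u'} = proj₂ (proj₂ (proj₂ ranked) u u')

    ≤⇒≯ : ∀ {a b} → NonStrict._≤_ a b → ¬ (b < a)
    ≤⇒≯ (inj₁ a<b) b<a = asym a<b b<a
    ≤⇒≯ (inj₂ a≈b) b<a = irrefl (Eq.sym a≈b) b<a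

  ≺-irrefl : Irreflexive _≡_ _≺_
  ≺-irrefl refl x≺x = irrefl Eq.refl (≺⇒< x≺x)

  ≺-cotrans : Cotransitive _≺_
  ≺-cotrans {x} {y} x≺y z with compare (f x) (f z)
  ... | tri< fx<fz _ _ = inj₁ (<⇒≺ fx<fz)
  ... | tri≈ _ fx≈fz _ = inj₂ (<⇒≺ (proj₂ <-resp-≈ fx≈fz (≺⇒< x≺y)))
  ... | tri> _ _ fz<fx = inj₂ (<⇒≺ (trans fz<fx (≺⇒< x≺y)))

  ≺-minimal-∈ : ∀ x xs → ∃ λ m → m ∈ₗ x ∷ xs × (∀ {y} → y ∈ₗ x ∷ xs → ¬ y ≺ m)
  ≺-minimal-∈ x xs = m , [ here , there ]′ (argmin-sel f x xs) , minimal
    where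
    m : Z
    m = argmin f x xs

    minimal : ∀ {y} → y ∈ₗ x ∷ xs → ¬ y ≺ m
    minimal (here refl) y≺m = ≤⇒≯ (f[argmin]≤f[⊤] {f = f} x xs) (≺⇒< y≺m)
    minimal (there y∈) y≺m = ≤⇒≯ (All.lookup (f[argmin]≤f[xs] {f = f} x xs) y∈) (≺⇒< y≺m)

module PreferentialStructure {Z : Set} (𝒴 : Pred (Pred Z 0ℓ) 0ℓ) (_≺_ : Rel Z 0ℓ) where

  open Structure 𝒴 _≺_

  ⊆-cl : {A : Pred Z 0ℓ} → A ⊆ cl A
  ⊆-cl a∈A _ _ A⊆X = A⊆X a∈A

  μ⊆ : {X : Pred Z 0ℓ} → X ∈ 𝒴 → μ X ⊆ X
  μ⊆ {X} X∈𝒴 x∈μX = x∈μX X X∈𝒴 proj₁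

  fromList⁺ : Z → List Z → Pred Z 0ℓ
  fromList⁺ x []       = ｛ x ｝
  fromList⁺ x (y ∷ ys) = ｛ x ｝ ∪ fromList⁺ y ys

  fromList⁺∈𝒴 : ContainsSingletons 𝒴 → ClosedUnion 𝒴 → ∀ x ys → fromList⁺ x ys ∈ 𝒴
  fromList⁺∈𝒴 sing un x []       = sing x
  fromList⁺∈𝒴 sing un x (y ∷ ys) = un _ _ (sing x) (fromList⁺∈𝒴 sing un y ys)

  ∈-fromList⁺⁺ : ∀ {z} x ys → z ∈ₗ x ∷ ys → z ∈ fromList⁺ x ys
  ∈-fromList⁺⁺ x []       (here refl) = refl
  ∈-fromList⁺⁺ x (y ∷ ys) (here refl) = inj₁ refl
  ∈-fromList⁺⁺ x (y ∷ ys) (there z∈)  = inj₂ (∈-fromList⁺⁺ y ys z∈)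

  ∈-fromList⁺⁻ : ∀ {z} x ys → z ∈ fromList⁺ x ys → z ∈ₗ x ∷ ys
  ∈-fromList⁺⁻ x []       refl        = here refl
  ∈-fromList⁺⁻ x (y ∷ ys) (inj₁ refl) = here refl
  ∈-fromList⁺⁻ x (y ∷ ys) (inj₂ z∈)   = there (∈-fromList⁺⁻ y ys z∈)

  ∈-∷-finite : {A : Pred Z 0ℓ} (finA : Finite A) {x : Z} → x ∈ A →
               ∀ {z} → z ∈ₗ x ∷ proj₁ finA → z ∈ A
  ∈-∷-finite (xs , A↔xs) x∈A = All.lookup (x∈A All.∷ All.tabulate (proj₂ (A↔xs _)))

  cl-finite⊆ : ContainsSingletons 𝒴 → ClosedUnion 𝒴 →
               {A : Pred Z 0ℓ} → Finite A → NonEmpty A → cl A ⊆ A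
  cl-finite⊆ sing un {A} finA@(xs , A↔xs) (a , a∈A) z∈clA =
    ∈-∷-finite finA a∈A (∈-fromList⁺⁻ a xs (z∈clA (fromList⁺ a xs) (fromList⁺∈𝒴 sing un a xs) A⊆))
    where
    A⊆ : A ⊆ fromList⁺ a xs
    A⊆ {w} w∈A = ∈-fromList⁺⁺ a xs (there (proj₁ (A↔xs w) w∈A))

  μZ-finite : ExcludedMiddle 0ℓ → {X : Pred Z 0ℓ} → Finite X → Finite (μZ X)
  μZ-finite lem (xs , X↔xs) = filter (λ _ → lem) xs , λ z →
      (λ z∈μZ → ∈-filter⁺ (λ _ → lem) {xs = xs} (proj₁ (X↔xs z) (proj₁ z∈μZ)) z∈μZ)
    , (λ z∈ → proj₂ (∈-filter⁻ (λ _ → lem) {xs = xs} z∈))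

  μZ-nonempty : Ranked _≺_ → {X : Pred Z 0ℓ} → Finite X → NonEmpty X → NonEmpty (μZ X)
  μZ-nonempty ranked finX@(xs , X↔xs) (x , x∈X)
    with RankedRelation.≺-minimal-∈ ranked x xs
  ... | m , m∈ , minimal =
    m , ∈-∷-finite finX x∈X m∈ , λ (y , y∈X , y≺m) → minimal (there (proj₁ (X↔xs y) y∈X)) y≺m

  ∉μ-pair : ContainsSingletons 𝒴 → Irreflexive _≡_ _≺_ →
            ∀ {x y} → y ≺ x → x ∉ μ (pair x y)
  ∉μ-pair sing ≺-irrefl {x} {y} y≺x x∈μ = ≺-irrefl (x∈μ ｛ y ｝ (sing y) μZ⊆｛y｝) y≺x
    where
    μZ⊆｛y｝ : μZ (pair x y) ⊆ ｛ y ｝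
    μZ⊆｛y｝ (inj₁ refl , x-minimal) = ⊥-elim (x-minimal (y , inj₂ refl , y≺x))
    μZ⊆｛y｝ (inj₂ refl , _)          = refl

  ∈μ-pair : Irreflexive _≡_ _≺_ →
            ∀ {X x y} → x ∈ μZ X → y ∈ X → x ∈ μ (pair x y)
  ∈μ-pair ≺-irrefl {_} {x} {y} (_ , x-minimal) y∈X = ⊆-cl (inj₁ refl , x-minimal-pair)
    where
    x-minimal-pair : ¬ (∃ λ z → z ∈ pair x y × z ≺ x)
    x-minimal-pair (_ , inj₁ refl , x≺x) = ≺-irrefl refl x≺x
    x-minimal-pair (_ , inj₂ refl , y≺x) = x-minimal (y , y∈X , y≺x)

  μZ≐μ₃ : ContainsSingletons 𝒴 → Irreflexive _≡_ _≺_ → (X : Pred Z 0ℓ) → μZ X ≐ μ₃ X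
  μZ≐μ₃ sing ≺-irrefl X =
      (λ x∈μZ → proj₁ x∈μZ , λ y → ∈μ-pair ≺-irrefl x∈μZ)
    , (λ (x∈X , x∈μpairs) → x∈X , λ (y , y∈X , y≺x) → ∉μ-pair sing ≺-irrefl y≺x (x∈μpairs y y∈X))

  μZ-∩ : Cotransitive _≺_ → {X Y : Pred Z 0ℓ} → X ⊆ Y →
         (∃ λ z → z ∈ μZ Y × z ∈ X) → μZ Y ∩ X ≐ μZ X
  μZ-∩ ≺-cotrans X⊆Y (z , (_ , z-minimal) , z∈X) =
      (λ ((_ , w-minimal) , w∈X) → w∈X , λ (v , v∈X , v≺w) → w-minimal (v , X⊆Y v∈X , v≺w))
    , (λ (w∈X , w-minimal) → (X⊆Y w∈X , λ (v , v∈Y , v≺w) →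
         [ (λ v≺z → z-minimal (v , v∈Y , v≺z)) , (λ z≺w → w-minimal (z , z∈X , z≺w)) ]′
           (≺-cotrans v≺w z))
       , w∈X)

  μ≐μZ-finite : ExcludedMiddle 0ℓ → ContainsSingletons 𝒴 → ClosedUnion 𝒴 → Ranked _≺_ →
                {X : Pred Z 0ℓ} → X ∈ 𝒴 → Finite X → μ X ≐ μZ X
  μ≐μZ-finite lem sing un ranked X∈𝒴 finX =
      (λ x∈μ → cl-finite⊆ sing un (μZ-finite lem finX)
                              (μZ-nonempty ranked finX (_ , μ⊆ X∈𝒴 x∈μ)) x∈μ)
    , ⊆-cl

  μ=fin-holds : ExcludedMiddle 0ℓ → ContainsSingletons 𝒴 → ClosedUnion 𝒴 → Ranked _≺_ → μ=fin
  μ=fin-holds lem sing un ranked X Y X∈𝒴 Y∈𝒴 finX finY X⊆Y (z , z∈μY , z∈X) =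
      (λ (w∈μY , w∈X) → ⊆-cl (proj₁ μZ∩ (proj₁ μY≐ w∈μY , w∈X)))
    , (λ w∈μX → let (w∈μZY , w∈X) = proj₂ μZ∩ (proj₁ μX≐ w∈μX) in ⊆-cl w∈μZY , w∈X)
    where
    μX≐ : μ X ≐ μZ X
    μX≐ = μ≐μZ-finite lem sing un ranked X∈𝒴 finX

    μY≐ : μ Y ≐ μZ Y
    μY≐ = μ≐μZ-finite lem sing un ranked Y∈𝒴 finY

    μZ∩ : μZ Y ∩ X ≐ μZ X
    μZ∩ = μZ-∩ (RankedRelation.≺-cotrans ranked) X⊆Y (z , proj₁ μY≐ z∈μY , z∈X)

  μ∈-holds : ExcludedMiddle 0ℓ → ContainsSingletons 𝒴 → Irreflexive _≡_ _≺_ → μ∈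
  μ∈-holds lem sing ≺-irrefl X _ a a∈X a∉μX with lem {∃ λ b → b ∈ X × b ≺ a}
  ... | yes (b , b∈X , b≺a) = b , b∈X , ∉μ-pair sing ≺-irrefl b≺a
  ... | no a-minimal        = ⊥-elim (a∉μX (⊆-cl (a∈X , a-minimal)))

  μ∅fin-holds : Ranked _≺_ → μ∅fin
  μ∅fin-holds ranked X _ finX neX =
    let (m , m∈μZ) = μZ-nonempty ranked finX neX in m , ⊆-cl m∈μZ

  μPR3-holds : ContainsSingletons 𝒴 → Irreflexive _≡_ _≺_ → μPR3
  μPR3-holds sing ≺-irrefl U _ (Y , Y∈𝒴 , rest⊆Y , _ , μU⊈Y) =
    μU⊈Y λ z∈μU → z∈μU Y Y∈𝒴 λ w∈μZ →
      rest⊆Y (⊆-cl w∈μZ , λ (_ , w∉μ₃) → w∉μ₃ (proj₁ (μZ≐μ₃ sing ≺-irrefl U) w∈μZ))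

fact4p14 : ExcludedMiddle 0ℓ → ExcludedMiddle (suc 0ℓ) →
           (Z : Set) (𝒴 : Pred (Pred Z 0ℓ) 0ℓ) →
           ContainsSingletons 𝒴 → ClosedUnion 𝒴 → ClosedIntersection 𝒴 →
           (_≺_ : Rel Z 0ℓ) → Ranked _≺_ →
           Structure.Fact4-14 𝒴 _≺_
fact4p14 lem _ Z 𝒴 sing un _ _≺_ ranked =
    μZ≐μ₃ sing ≺-irrefl
  , (λ X _ → μZ≐μ₃ sing ≺-irrefl X)
  , (λ _ → μ≐μZ-finite lem sing un ranked)
  , μ=fin-holds lem sing un ranked
  , μ∈-holds lem sing ≺-irrefl
  , μ∅fin-holds ranked
  , μPR3-holds sing ≺-irrefl
  where
  open PreferentialStructure 𝒴 _≺_
  open RankedRelation ranked using (≺-irrefl)
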